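{- Let $d,n\geq1$ and let $\mathbf{x},\mathbf{y}\in\mathbb{Z}^{n+1}$ be two linearly independent primitive vectors. Then $\mathcal{G}(\nu_{d,n}(\mathbf{x}),\nu_{d,n}(\mathbf{y}))=\mathcal{G}(\mathbf{x},\mathbf{y})$.
   Context: A vector in $\mathbb{Z}^{n+1}$ is primitive if its coordinates have gcd $1$. $\nu_{d,n}:\mathbb{R}^{n+1}\to\mathbb{R}^{N_{d,n}}$, $N_{d,n}=\binom{n+d}{d}$, is the Veronese map listing all monomials of degree $d$ in $x_0,\dots,x_n$ (coefficient $1$) in lexicographic order. For linearly independent $\mathbf{c}_1,\mathbf{c}_2\in\mathbb{Z}^N$, $\mathcal{G}(\mathbf{c}_1,\mathbf{c}_2)$ is the gcd of the $2\times2$ minors of the $N\times2$ matrix with columns $\mathbf{c}_1,\mathbf{c}_2$. -}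

module Defs where

open import Data.Nat as ℕ using (ℕ; zero; suc; _∸_)
open import Data.Integer using (ℤ; _*_; _-_; _^_; 0ℤ; 1ℤ)
open import Data.Integer.GCD using (gcd)
open import Data.Fin using (Fin)
open import Data.Vec as Vec using (Vec; []; _∷_; toList)
open import Data.List as List using (List; []; _∷_; _++_; map; concatMap; downFrom; foldr; zip)
open import Data.Product using (_×_; _,_)
open import Relation.Binary.PropositionalEquality using (_≡_)

-- gcd of a finite list of integers (gcd of the empty list is 0)
gcdList : List ℤ → ℤ
gcdList = foldr gcd 0ℤ

Primitive : ∀ {m} → Vec ℤ m → Set
Primitive v = gcdList (toList v) ≡ 1ℤ

-- linear independence of two integer vectors (over ℚ; equivalently, by
-- clearing denominators, over ℤ): the only integer relation a x + b y = 0
-- is the trivial one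
LinIndep : ∀ {m} → Vec ℤ m → Vec ℤ m → Set
LinIndep x y = ∀ (a b : ℤ) →
  Vec.zipWith (λ xi yi → a * xi Data.Integer.+ b * yi) x y ≡ Vec.replicate _ 0ℤ →
  (a ≡ 0ℤ) × (b ≡ 0ℤ)

-- exponent vectors of all monomials of degree d in k variables,
-- in lexicographic order (x0^d first, i.e. exponent of first variable decreasing)
exponents : (k : ℕ) → ℕ → List (Vec ℕ k)
exponents zero zero = [] ∷ []
exponents zero (suc d) = []
exponents (suc k) d =
  concatMap (λ e → map (e ∷_) (exponents k (d ∸ e))) (downFrom (suc d))

monomial : ∀ {k} → Vec ℕ k → Vec ℤ k → ℤ
monomial [] [] = 1ℤ
monomial (e ∷ es) (x ∷ xs) = (x ^ e) * monomial es xs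

-- the Veronese map ν_{d,n} : ℤ^(n+1) → ℤ^(N_{d,n}), monomials with coefficient 1
veronese : (d : ℕ) → ∀ {k} → Vec ℤ k → List ℤ
veronese d {k} x = map (λ e → monomial e x) (exponents k d)

-- all 2×2 minors of the N×2 matrix with rows (pᵢ, qᵢ), rows i < j
minors : List (ℤ × ℤ) → List ℤ
minors [] = []
minors ((a , b) ∷ rs) = map (λ { (c , e) → a * e - b * c }) rs ++ minors rs

𝒢 : List ℤ → List ℤ → ℤ
𝒢 c₁ c₂ = gcdList (minors (zip c₁ c₂))

-- Write X_e, Y_e for the monomial with exponent e evaluated at x and y.  Every
-- monomial minor X_e Y_f − Y_e X_f of degree d + 1 is a combination of a
-- monomial minor of degree d and a coordinate minor xᵢyⱼ − yᵢxⱼ, so by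
-- induction on d every divisor of the coordinate minors divides the monomial
-- minors.  Conversely, a common divisor q of the degree-(d + 1) monomial minors
-- divides Δ X_w Y_u X_f for each coordinate minor Δ and all monomials w, u, f
-- of the appropriate degrees; since the monomials of a given degree of a
-- primitive vector have gcd 1, these factors cancel one after another and q
-- divides Δ.
module Submission where

open import Defs
open import Data.Nat using (ℕ; suc; _≤_)
open import Data.Integer using (ℤ)
open import Data.Vec using (Vec; toList)
open import Relation.Binary.PropositionalEquality using (_≡_)

open import Data.Nat using (zero; _∸_; s≤s)
import Data.Nat as ℕ
import Data.Nat.Properties as ℕₚ
import Data.Nat.Divisibility as ℕᵈ
import Data.Nat.GCD as ℕᵍ
open import Data.Integer using (+_; _*_; _-_; _+_; -_; 0ℤ; 1ℤ; ∣_∣; _^_)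
import Data.Integer.Properties as ℤₚ
open import Data.Integer.GCD using (gcd; gcd-greatest; gcd[i,j]∣i; gcd[i,j]∣j)
open import Data.Integer.Divisibility.Signed
  using (_∣_; ∣ᵤ⇒∣; ∣⇒∣ᵤ; ∣-trans; ∣m∣n⇒∣m+n; ∣m∣n⇒∣m-n; ∣m⇒∣-m; ∣n⇒∣m*n)
open import Data.Integer.Tactic.RingSolver using (solve-∀)
open import Data.Fin using (Fin)
open import Data.Vec using ([]; _∷_; lookup; replicate; sum; updateAt)
open import Data.List using (List; []; _∷_; map; zip; downFrom)
open import Data.List.Relation.Unary.Any using (here; there)
open import Data.List.Membership.Propositional using (_∈_; find; lose)
open import Data.List.Membership.Propositional.Properties
  using (∈-map⁺; ∈-map⁻; ∈-++⁺ˡ; ∈-++⁺ʳ; ∈-++⁻; ∈-concatMap⁺; ∈-concatMap⁻; ∈-downFrom⁺; ∈-downFrom⁻)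
open import Data.Product using (∃; ∃₂; _×_; _,_; proj₁; proj₂)
open import Data.Sum using (inj₁; inj₂)
open import Relation.Binary.PropositionalEquality
  using (refl; sym; trans; cong; cong₂; subst; module ≡-Reasoning)

private
  variable
    k : ℕ

∣0 : ∀ c → c ∣ 0ℤ
∣0 c = ∣ᵤ⇒∣ (ℕᵈ._∣0 ∣ c ∣)

gcdList-∣ : ∀ {l a} → a ∈ l → gcdList l ∣ a
gcdList-∣ {a ∷ l} (here refl) = ∣ᵤ⇒∣ (gcd[i,j]∣i a (gcdList l))
gcdList-∣ {b ∷ l} (there a∈l) = ∣-trans (∣ᵤ⇒∣ (gcd[i,j]∣j b (gcdList l))) (gcdList-∣ a∈l)

∣-gcdList : ∀ {c} l → (∀ {a} → a ∈ l → c ∣ a) → c ∣ gcdList l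
∣-gcdList {c} [] _ = ∣0 c
∣-gcdList {c} (a ∷ l) c∣l =
  ∣ᵤ⇒∣ (gcd-greatest {a} {gcdList l} {c} (∣⇒∣ᵤ (c∣l (here refl))) (∣⇒∣ᵤ (∣-gcdList l (λ a∈l → c∣l (there a∈l)))))

gcdList≡+∣gcdList∣ : ∀ l → gcdList l ≡ + ∣ gcdList l ∣
gcdList≡+∣gcdList∣ [] = refl
gcdList≡+∣gcdList∣ (a ∷ l) = refl

gcdList-∣-antisym : ∀ l l′ → gcdList l ∣ gcdList l′ → gcdList l′ ∣ gcdList l → gcdList l ≡ gcdList l′
gcdList-∣-antisym l l′ l∣l′ l′∣l = begin
  gcdList l           ≡⟨ gcdList≡+∣gcdList∣ l ⟩
  + ∣ gcdList l ∣     ≡⟨ cong +_ (ℕᵈ.∣-antisym (∣⇒∣ᵤ l∣l′) (∣⇒∣ᵤ l′∣l)) ⟩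
  + ∣ gcdList l′ ∣    ≡⟨ sym (gcdList≡+∣gcdList∣ l′) ⟩
  gcdList l′          ∎
  where open ≡-Reasoning

∣*gcd∣≡∣gcd[*,*]∣ : ∀ z a b → ∣ z * gcd a b ∣ ≡ ∣ gcd (z * a) (z * b) ∣
∣*gcd∣≡∣gcd[*,*]∣ z a b = trans (ℤₚ.abs-* z (gcd a b))
  (trans (ℕᵍ.c*gcd[m,n]≡gcd[cm,cn] (∣ z ∣) (∣ a ∣) (∣ b ∣))
         (sym (cong₂ ℕᵍ.gcd (ℤₚ.abs-* z a) (ℤₚ.abs-* z b))))

∣*-gcd : ∀ {q} z a b → q ∣ z * a → q ∣ z * b → q ∣ z * gcd a b
∣*-gcd {q} z a b q∣za q∣zb = ∣ᵤ⇒∣ (subst (∣ q ∣ ℕᵈ.∣_) (sym (∣*gcd∣≡∣gcd[*,*]∣ z a b))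
  (gcd-greatest {z * a} {z * b} {q} (∣⇒∣ᵤ q∣za) (∣⇒∣ᵤ q∣zb)))

∣*-gcdList-toList : ∀ {q} z (v : Vec ℤ k) → (∀ i → q ∣ z * lookup v i) → q ∣ z * gcdList (toList v)
∣*-gcdList-toList {q = q} z [] _ = ∣n⇒∣m*n z (∣0 q)
∣*-gcdList-toList z (a ∷ v) q∣zv =
  ∣*-gcd z a (gcdList (toList v)) (q∣zv Fin.zero) (∣*-gcdList-toList z v (λ i → q∣zv (Fin.suc i)))

det : ℤ × ℤ → ℤ × ℤ → ℤ
det (a , b) (c , e) = a * e - b * c

det-self : ∀ p → det p p ≡ 0ℤ
det-self (a , b) = lemma a b
  where
  lemma : ∀ a b → a * b - b * a ≡ 0ℤ
  lemma = solve-∀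

det-swap : ∀ p q → det q p ≡ - det p q
det-swap (a , b) (c , e) = lemma a b c e
  where
  lemma : ∀ a b c e → c * b - e * a ≡ - (a * e - b * c)
  lemma = solve-∀

DividesMinors : ℤ → List (ℤ × ℤ) → Set
DividesMinors c L = ∀ {p q} → p ∈ L → q ∈ L → c ∣ det p q

∈-minors⁻ : ∀ L {m} → m ∈ minors L → ∃₂ λ p q → p ∈ L × q ∈ L × m ≡ det p q
∈-minors⁻ (p ∷ L) m∈ with ∈-++⁻ (map (det p) L) m∈
... | inj₁ m∈pL with ∈-map⁻ (det p) m∈pL
...   | q , q∈L , refl = p , q , here refl , there q∈L , refl
∈-minors⁻ (p ∷ L) m∈ | inj₂ m∈L with ∈-minors⁻ L m∈L
... | q , r , q∈L , r∈L , refl = q , r , there q∈L , there r∈L , refl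

∣-minors⇒DividesMinors : ∀ {c} L → (∀ {m} → m ∈ minors L → c ∣ m) → DividesMinors c L
∣-minors⇒DividesMinors {c} (p ∷ L) c∣ (here refl) (here refl) = subst (c ∣_) (sym (det-self p)) (∣0 c)
∣-minors⇒DividesMinors (p ∷ L) c∣ (here refl) (there q∈L) = c∣ (∈-++⁺ˡ (∈-map⁺ (det p) q∈L))
∣-minors⇒DividesMinors {c} (p ∷ L) c∣ {q} (there q∈L) (here refl) =
  subst (c ∣_) (sym (det-swap p q)) (∣m⇒∣-m (c∣ (∈-++⁺ˡ (∈-map⁺ (det p) q∈L))))
∣-minors⇒DividesMinors (p ∷ L) c∣ (there q∈L) (there r∈L) =
  ∣-minors⇒DividesMinors L (λ m∈ → c∣ (∈-++⁺ʳ (map (det p) L) m∈)) q∈L r∈L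

gcdList-minors-DividesMinors : ∀ L → DividesMinors (gcdList (minors L)) L
gcdList-minors-DividesMinors L = ∣-minors⇒DividesMinors L gcdList-∣

DividesMinors⇒∣gcdList-minors : ∀ {c} L → DividesMinors c L → c ∣ gcdList (minors L)
DividesMinors⇒∣gcdList-minors {c} L c∣det = ∣-gcdList (minors L) c∣minor
  where
  c∣minor : ∀ {m} → m ∈ minors L → c ∣ m
  c∣minor m∈ with ∈-minors⁻ L m∈
  ... | p , q , p∈L , q∈L , refl = c∣det p∈L q∈L

∈-exponents⁻ : ∀ k d {e} → e ∈ exponents k d → sum e ≡ d
∈-exponents⁻ zero zero (here refl) = refl
∈-exponents⁻ (suc k) d e∈
  with find (∈-concatMap⁻ (λ a → map (a ∷_) (exponents k (d ∸ a))) {xs = downFrom (suc d)} e∈)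
... | a , a∈ , e∈a∷ with ∈-map⁻ (a ∷_) e∈a∷
...   | es , es∈ , refl =
  trans (cong (a ℕ.+_) (∈-exponents⁻ k (d ∸ a) es∈)) (ℕₚ.m+[n∸m]≡n (ℕₚ.≤-pred (∈-downFrom⁻ a∈)))

∈-exponents⁺ : ∀ k d {e} → sum e ≡ d → e ∈ exponents k d
∈-exponents⁺ zero zero {[]} refl = here refl
∈-exponents⁺ (suc k) d {a ∷ es} refl =
  ∈-concatMap⁺ (λ b → map (b ∷_) (exponents k (d ∸ b))) {xs = downFrom (suc d)}
    (lose (∈-downFrom⁺ (s≤s (ℕₚ.m≤m+n a (sum es))))
          (∈-map⁺ (a ∷_) (∈-exponents⁺ k (d ∸ a) (sym (ℕₚ.m+n∸m≡n a (sum es))))))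

sum-updateAt-suc : ∀ (w : Vec ℕ k) i → sum (updateAt w i suc) ≡ suc (sum w)
sum-updateAt-suc (a ∷ w) Fin.zero = refl
sum-updateAt-suc (a ∷ w) (Fin.suc i) = trans (cong (a ℕ.+_) (sum-updateAt-suc w i)) (ℕₚ.+-suc a (sum w))

sum≡suc⇒updateAt-suc : ∀ (e : Vec ℕ k) {D} → sum e ≡ suc D →
  ∃₂ λ w i → sum w ≡ D × e ≡ updateAt w i suc
sum≡suc⇒updateAt-suc (zero ∷ e) se with sum≡suc⇒updateAt-suc e se
... | w , i , sw , refl = zero ∷ w , Fin.suc i , sw , refl
sum≡suc⇒updateAt-suc (suc a ∷ e) se = a ∷ e , Fin.zero , ℕₚ.suc-injective se , refl

monomial-updateAt-suc : ∀ (w : Vec ℕ k) i x → monomial (updateAt w i suc) x ≡ monomial w x * lookup x i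
monomial-updateAt-suc (a ∷ w) Fin.zero (x₀ ∷ x) = lemma x₀ (x₀ ^ a) (monomial w x)
  where
  lemma : ∀ x₀ p m → x₀ * p * m ≡ p * m * x₀
  lemma = solve-∀
monomial-updateAt-suc (a ∷ w) (Fin.suc i) (x₀ ∷ x) =
  trans (cong (x₀ ^ a *_) (monomial-updateAt-suc w i x)) (sym (ℤₚ.*-assoc (x₀ ^ a) (monomial w x) (lookup x i)))

sum≡0⇒monomial≡1 : ∀ (e : Vec ℕ k) x → sum e ≡ 0 → monomial e x ≡ 1ℤ
sum≡0⇒monomial≡1 [] [] _ = refl
sum≡0⇒monomial≡1 (zero ∷ e) (x₀ ∷ x) se = trans (ℤₚ.*-identityˡ (monomial e x)) (sum≡0⇒monomial≡1 e x se)

sum-replicate-0 : ∀ k → sum (replicate k 0) ≡ 0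
sum-replicate-0 zero = refl
sum-replicate-0 (suc k) = sum-replicate-0 k

-- Since gcd(x) = 1, X_w is the gcd of the degree-(D + 1) monomials X_w xᵢ.
∣*monomials⇒∣ : ∀ {x : Vec ℤ k} → Primitive x → ∀ D {q} z →
  (∀ w → sum w ≡ D → q ∣ z * monomial w x) → q ∣ z
∣*monomials⇒∣ {k} {x} _ zero {q} z q∣ =
  subst (q ∣_) z*1≡z (q∣ (replicate k 0) (sum-replicate-0 k))
  where
  z*1≡z : z * monomial (replicate k 0) x ≡ z
  z*1≡z = trans (cong (z *_) (sum≡0⇒monomial≡1 (replicate k 0) x (sum-replicate-0 k))) (ℤₚ.*-identityʳ z)
∣*monomials⇒∣ {x = x} px (suc D) {q} z q∣ = ∣*monomials⇒∣ px D z q∣zXw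
  where
  q∣zXw : ∀ w → sum w ≡ D → q ∣ z * monomial w x
  q∣zXw w sw = subst (q ∣_) (trans (cong (z * monomial w x *_) px) (ℤₚ.*-identityʳ _))
    (∣*-gcdList-toList (z * monomial w x) x λ i →
      subst (q ∣_) (trans (cong (z *_) (monomial-updateAt-suc w i x)) (sym (ℤₚ.*-assoc z _ _)))
        (q∣ (updateAt w i suc) (trans (sum-updateAt-suc w i) (cong suc sw))))

monomialRow : Vec ℤ k → Vec ℤ k → Vec ℕ k → ℤ × ℤ
monomialRow x y e = monomial e x , monomial e y

coordRow : Vec ℤ k → Vec ℤ k → Fin k → ℤ × ℤ
coordRow x y i = lookup x i , lookup y i

monomialRow-updateAt-suc : ∀ (x y : Vec ℤ k) w i →
  monomialRow x y (updateAt w i suc) ≡ (monomial w x * lookup x i , monomial w y * lookup y i)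
monomialRow-updateAt-suc x y w i = cong₂ _,_ (monomial-updateAt-suc w i x) (monomial-updateAt-suc w i y)

monomialRow-degree-0 : ∀ (x y : Vec ℤ k) e → sum e ≡ 0 → monomialRow x y e ≡ (1ℤ , 1ℤ)
monomialRow-degree-0 x y e se = cong₂ _,_ (sum≡0⇒monomial≡1 e x se) (sum≡0⇒monomial≡1 e y se)

det-*-* : ∀ a b c e s t s′ t′ →
  det (a * s , b * t) (c * s′ , e * t′) ≡ (a * e) * det (s , t) (s′ , t′) + (s′ * t) * det (a , b) (c , e)
det-*-* = lemma
  where
  lemma : ∀ a b c e s t s′ t′ →
    a * s * (e * t′) - b * t * (c * s′) ≡ a * e * (s * t′ - t * s′) + s′ * t * (a * e - b * c)
  lemma = solve-∀

∣coordMinors⇒∣monomialMinors : ∀ {g} (x y : Vec ℤ k) →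
  (∀ i j → g ∣ det (coordRow x y i) (coordRow x y j)) →
  ∀ D e f → sum e ≡ D → sum f ≡ D → g ∣ det (monomialRow x y e) (monomialRow x y f)
∣coordMinors⇒∣monomialMinors {g = g} x y _ zero e f se sf =
  subst (g ∣_) (sym (trans (cong₂ det (monomialRow-degree-0 x y e se) (monomialRow-degree-0 x y f sf))
                           (det-self (1ℤ , 1ℤ))))
    (∣0 g)
∣coordMinors⇒∣monomialMinors {g = g} x y g∣coord (suc D) e f se sf
  with sum≡suc⇒updateAt-suc e se | sum≡suc⇒updateAt-suc f sf
... | w , i , sw , refl | u , j , su , refl =
  subst (g ∣_) (sym (trans (cong₂ det (monomialRow-updateAt-suc x y w i) (monomialRow-updateAt-suc x y u j))
                           (det-*-* (monomial w x) (monomial w y) (monomial u x) (monomial u y)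
                                    (lookup x i) (lookup y i) (lookup x j) (lookup y j))))
    (∣m∣n⇒∣m+n (∣n⇒∣m*n (monomial w x * monomial u y) (g∣coord i j))
               (∣n⇒∣m*n (lookup x j * lookup y i) (∣coordMinors⇒∣monomialMinors x y g∣coord D w u sw su)))

∣monomialMinors⇒∣coordMinors : ∀ {q} {x y : Vec ℤ k} → Primitive x → Primitive y → ∀ D →
  (∀ e f → sum e ≡ suc D → sum f ≡ suc D → q ∣ det (monomialRow x y e) (monomialRow x y f)) →
  ∀ i j → q ∣ det (coordRow x y i) (coordRow x y j)
∣monomialMinors⇒∣coordMinors {q = q} {x} {y} px py D q∣ i j =
  ∣*monomials⇒∣ px D Δ λ w sw →
  ∣*monomials⇒∣ py D (Δ * monomial w x) λ u su →
  ∣*monomials⇒∣ px (suc D) (Δ * monomial w x * monomial u y) λ f sf →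
    subst (q ∣_) (sym (eliminate (monomial w x) (monomialRow x y f) (monomialRow x y u)))
      (∣m∣n⇒∣m-n (∣n⇒∣m*n (monomial w x * lookup x i) (q∣det[f,u↑m] f u j sf su))
                 (∣n⇒∣m*n (monomial w x * lookup x j) (q∣det[f,u↑m] f u i sf su)))
  where
  Δ : ℤ
  Δ = det (coordRow x y i) (coordRow x y j)

  scale : ℤ × ℤ → Fin _ → ℤ × ℤ
  scale (a , b) m = a * lookup x m , b * lookup y m

  q∣det[f,u↑m] : ∀ f u m → sum f ≡ suc D → sum u ≡ D → q ∣ det (monomialRow x y f) (scale (monomialRow x y u) m)
  q∣det[f,u↑m] f u m sf su = subst (λ r → q ∣ det (monomialRow x y f) r) (monomialRow-updateAt-suc x y u m)
    (q∣ f (updateAt u m suc) sf (trans (sum-updateAt-suc u m) (cong suc su)))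

  eliminate : ∀ W p r → Δ * W * proj₂ r * proj₁ p ≡
    (W * lookup x i) * det p (scale r j) - (W * lookup x j) * det p (scale r i)
  eliminate W (P₁ , P₂) (R₁ , R₂) = lemma W P₁ P₂ R₁ R₂ (lookup x i) (lookup y i) (lookup x j) (lookup y j)
    where
    lemma : ∀ W P₁ P₂ R₁ R₂ s t s′ t′ →
      (s * t′ - t * s′) * W * R₂ * P₁ ≡
      W * s * (P₁ * (R₂ * t′) - P₂ * (R₁ * s′)) - W * s′ * (P₁ * (R₂ * t) - P₂ * (R₁ * s))
    lemma = solve-∀

zip-map-map : ∀ {A B C : Set} (f : A → B) (g : A → C) xs → zip (map f xs) (map g xs) ≡ map (λ a → f a , g a) xs
zip-map-map f g [] = refl
zip-map-map f g (a ∷ xs) = cong ((f a , g a) ∷_) (zip-map-map f g xs)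

zip-veronese : ∀ d (x y : Vec ℤ k) → zip (veronese d x) (veronese d y) ≡ map (monomialRow x y) (exponents k d)
zip-veronese {k} d x y = zip-map-map (λ e → monomial e x) (λ e → monomial e y) (exponents k d)

coordRow∈zip : ∀ (x y : Vec ℤ k) i → coordRow x y i ∈ zip (toList x) (toList y)
coordRow∈zip (a ∷ x) (b ∷ y) Fin.zero = here refl
coordRow∈zip (a ∷ x) (b ∷ y) (Fin.suc i) = there (coordRow∈zip x y i)

∈-zip-toList⁻ : ∀ (x y : Vec ℤ k) {p} → p ∈ zip (toList x) (toList y) → ∃ λ i → p ≡ coordRow x y i
∈-zip-toList⁻ (a ∷ x) (b ∷ y) (here refl) = Fin.zero , refl
∈-zip-toList⁻ (a ∷ x) (b ∷ y) (there p∈) with ∈-zip-toList⁻ x y p∈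
... | i , refl = Fin.suc i , refl

DividesMinors-coords⇒veronese : ∀ {g} d (x y : Vec ℤ k) →
  DividesMinors g (zip (toList x) (toList y)) → DividesMinors g (zip (veronese d x) (veronese d y))
DividesMinors-coords⇒veronese {k} d x y g∣coords p∈ q∈
  rewrite zip-veronese d x y with ∈-map⁻ (monomialRow x y) p∈ | ∈-map⁻ (monomialRow x y) q∈
... | e , e∈ , refl | f , f∈ , refl =
  ∣coordMinors⇒∣monomialMinors x y (λ i j → g∣coords (coordRow∈zip x y i) (coordRow∈zip x y j))
    d e f (∈-exponents⁻ k d e∈) (∈-exponents⁻ k d f∈)

DividesMinors-veronese⇒coords : ∀ {q} D {x y : Vec ℤ k} → Primitive x → Primitive y →
  DividesMinors q (zip (veronese (suc D) x) (veronese (suc D) y)) → DividesMinors q (zip (toList x) (toList y))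
DividesMinors-veronese⇒coords {k} D {x} {y} px py q∣veronese p∈ r∈
  with ∈-zip-toList⁻ x y p∈ | ∈-zip-toList⁻ x y r∈
... | i , refl | j , refl =
  ∣monomialMinors⇒∣coordMinors px py D
    (λ e f se sf → q∣veronese (monomialRow∈ e se) (monomialRow∈ f sf)) i j
  where
  monomialRow∈ : ∀ e → sum e ≡ suc D → monomialRow x y e ∈ zip (veronese (suc D) x) (veronese (suc D) y)
  monomialRow∈ e se = subst (_ ∈_) (sym (zip-veronese (suc D) x y))
    (∈-map⁺ (monomialRow x y) (∈-exponents⁺ k (suc D) {e} se))

lemma3p11 : (d n : ℕ) → 1 ≤ d → 1 ≤ n → (x y : Vec ℤ (suc n)) →
    Primitive x → Primitive y → LinIndep x y →
    𝒢 (veronese d x) (veronese d y) ≡ 𝒢 (toList x) (toList y)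
lemma3p11 (suc D) n _ _ x y px py _ =
  gcdList-∣-antisym (minors V) (minors C)
    (DividesMinors⇒∣gcdList-minors C
      (DividesMinors-veronese⇒coords D px py (gcdList-minors-DividesMinors V)))
    (DividesMinors⇒∣gcdList-minors V
      (DividesMinors-coords⇒veronese (suc D) x y (gcdList-minors-DividesMinors C)))
  where
  V C : List (ℤ × ℤ)
  V = zip (veronese (suc D) x) (veronese (suc D) y)
  C = zip (toList x) (toList y)
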